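{- (1) The category of uniform-iteration algebras and the category of search-algebras are isomorphic, via the identity-on-morphisms assignments $(A,(-)^\dagger)\mapsto(A,\mathrm{out}^\dagger\colon DA\to A)$ and $(A,a\colon DA\to A)\mapsto(A,\ f\mapsto a\circ\mathrm{coit}\,f)$ for $f\colon X\to A+X$. (2) Elgot algebras are precisely those $D$-algebras which are both search-algebras and $\mathbb{D}$-algebras (Eilenberg–Moore algebras of the delay monad).
   Context: $\mathbf{C}$ is an extensive category with finite products, a stable natural number object and exponentials $X^{\mathbb{N}}$. $DX$ is the final coalgebra of $X+(-)$ with invertible structure $\mathrm{out}\colon DX\to X+DX$; $\mathrm{now}=\mathrm{out}^{ -1}\mathrm{inl}$, $\mathrm{later}=\mathrm{out}^{ -1}\mathrm{inr}$; for $f\colon Y\to X+Y$, $\mathrm{coit}\,f\colon Y\to DX$ is the unique morphism with $\mathrm{out}\,(\mathrm{coit}\,f)=(\mathrm{id}+\mathrm{coit}\,f)f$. The delay monad $\mathbb{D}$ has unit $\mathrm{now}$ and multiplication $\mu=\mathrm{id}^*$ where $f^*$ is the unique morphism with $\mathrm{out}\,f^*=[\mathrm{out}\,f,\mathrm{inr}\,f^*]\mathrm{out}$. A $D$-algebra is $(A,a\colon DA\to A)$, morphisms being morphisms commuting with the structures; a $\mathbb{D}$-algebra additionally satisfies $a\,\mathrm{now}=\mathrm{id}$, $a\mu=a\,Da$. A search-algebra is a $D$-algebra with $a\,\mathrm{now}=\mathrm{id}$ and $a\,\mathrm{later}=a$. A uniform-iteration algebra is an object $A$ with an operator $f\mapsto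 f^\dagger$ ($f\colon X\to A+X$, $f^\dagger\colon X\to A$) satisfying (Fixpoint) $f^\dagger=[\mathrm{id},f^\dagger]f$ and (Uniformity) $(\mathrm{id}+h)f=gh\Rightarrow f^\dagger=g^\dagger h$; morphisms $h$ satisfy $hf^\dagger=((h+\mathrm{id})f)^\dagger$. An Elgot algebra additionally satisfies (Compositionality) $((f^\dagger+\mathrm{id})h)^\dagger=([(\mathrm{id}+\mathrm{inl})f,\mathrm{inr}\,\mathrm{inr}][\mathrm{inl},h])^\dagger\mathrm{inr}$ for all $h\colon Y\to X+Y$, $f\colon X\to A+X$; in (2) an Elgot algebra is identified with the $D$-algebra $(A,\mathrm{out}^\dagger)$. -}

module Defs where

open import Level using (Level; _⊔_) renaming (suc to lsuc)
open import Data.Product using (Σ; Σ-syntax; _×_; _,_; proj₁; proj₂)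
open import Relation.Binary using (Rel; IsEquivalence)
open import Function.Bundles using (_⇔_)

record Category (o ℓ e : Level) : Set (lsuc (o ⊔ ℓ ⊔ e)) where
  infixr 9 _∘_
  infix  4 _≈_
  infixr 0 _⇒_
  field
    Obj   : Set o
    _⇒_   : Obj → Obj → Set ℓ
    _≈_   : ∀ {A B} → Rel (A ⇒ B) e
    id    : ∀ {A} → A ⇒ A
    _∘_   : ∀ {A B C} → B ⇒ C → A ⇒ B → A ⇒ C
    equiv     : ∀ {A B} → IsEquivalence (_≈_ {A} {B})
    ∘-resp-≈  : ∀ {A B C} {f h : B ⇒ C} {g i : A ⇒ B} → f ≈ h → g ≈ i → f ∘ g ≈ h ∘ i
    assoc     : ∀ {A B C D} {f : A ⇒ B} {g : B ⇒ C} {h : C ⇒ D} → (h ∘ g) ∘ f ≈ h ∘ (g ∘ f)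
    identityˡ : ∀ {A B} {f : A ⇒ B} → id ∘ f ≈ f
    identityʳ : ∀ {A B} {f : A ⇒ B} → f ∘ id ≈ f

module Universal {o ℓ e} (C : Category o ℓ e) where
  open Category C

  ∃!≈ : ∀ {A B} → (A ⇒ B → Set e) → Set (ℓ ⊔ e)
  ∃!≈ {A} {B} P = Σ[ u ∈ A ⇒ B ] (P u × (∀ (v : A ⇒ B) → P v → v ≈ u))

  IsInitial : Obj → Set (o ⊔ ℓ ⊔ e)
  IsInitial I = ∀ X → Σ[ u ∈ I ⇒ X ] (∀ (v : I ⇒ X) → v ≈ u)

  IsTerminal : Obj → Set (o ⊔ ℓ ⊔ e)
  IsTerminal T = ∀ X → Σ[ u ∈ X ⇒ T ] (∀ (v : X ⇒ T) → v ≈ u)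

  IsCoproduct : ∀ {A B S} → A ⇒ S → B ⇒ S → Set (o ⊔ ℓ ⊔ e)
  IsCoproduct {A} {B} {S} i₁ i₂ =
    ∀ {X} (f : A ⇒ X) (g : B ⇒ X) → ∃!≈ (λ u → (u ∘ i₁ ≈ f) × (u ∘ i₂ ≈ g))

  IsProduct : ∀ {A B P} → P ⇒ A → P ⇒ B → Set (o ⊔ ℓ ⊔ e)
  IsProduct {A} {B} {P} p₁ p₂ =
    ∀ {X} (f : X ⇒ A) (g : X ⇒ B) → ∃!≈ (λ u → (p₁ ∘ u ≈ f) × (p₂ ∘ u ≈ g))

  IsPullback : ∀ {P A B Z} → P ⇒ A → P ⇒ B → A ⇒ Z → B ⇒ Z → Set (o ⊔ ℓ ⊔ e)
  IsPullback {P} {A} {B} {Z} p₁ p₂ f g =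
    (f ∘ p₁ ≈ g ∘ p₂) ×
    (∀ {Q} (q₁ : Q ⇒ A) (q₂ : Q ⇒ B) → f ∘ q₁ ≈ g ∘ q₂ →
       ∃!≈ (λ u → (p₁ ∘ u ≈ q₁) × (p₂ ∘ u ≈ q₂)))

record Setting (o ℓ e : Level) : Set (lsuc (o ⊔ ℓ ⊔ e)) where
  field
    cat : Category o ℓ e
  open Category cat
  open Universal cat
  infixr 6 _+_
  infixr 7 _×₀_
  field
    𝟘          : Obj
    𝟘-initial  : IsInitial 𝟘
    _+_        : Obj → Obj → Obj
    inl        : ∀ {A B} → A ⇒ A + B
    inr        : ∀ {A B} → B ⇒ A + B
    coproduct  : ∀ {A B} → IsCoproduct (inl {A} {B}) (inr {A} {B})

  [_,_] : ∀ {A B X} → A ⇒ X → B ⇒ X → A + B ⇒ X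
  [ f , g ] = proj₁ (coproduct f g)

  _+₁_ : ∀ {A B A' B'} → A ⇒ A' → B ⇒ B' → A + B ⇒ A' + B'
  f +₁ g = [ inl ∘ f , inr ∘ g ]

  field
    pullback-inl : ∀ {A B X} (h : X ⇒ A + B) →
                   Σ[ P ∈ Obj ] Σ[ m ∈ P ⇒ X ] Σ[ k ∈ P ⇒ A ] IsPullback m k h inl
    pullback-inr : ∀ {A B X} (h : X ⇒ A + B) →
                   Σ[ P ∈ Obj ] Σ[ m ∈ P ⇒ X ] Σ[ k ∈ P ⇒ B ] IsPullback m k h inr
    extensive    : ∀ {A B X X₁ X₂} (h : X ⇒ A + B)
                     (m₁ : X₁ ⇒ X) (m₂ : X₂ ⇒ X) (h₁ : X₁ ⇒ A) (h₂ : X₂ ⇒ B) →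
                   h ∘ m₁ ≈ inl ∘ h₁ → h ∘ m₂ ≈ inr ∘ h₂ →
                   IsCoproduct m₁ m₂ ⇔ (IsPullback m₁ h₁ h inl × IsPullback m₂ h₂ h inr)

    𝟙          : Obj
    𝟙-terminal : IsTerminal 𝟙
    _×₀_       : Obj → Obj → Obj
    π₁         : ∀ {A B} → A ×₀ B ⇒ A
    π₂         : ∀ {A B} → A ×₀ B ⇒ B
    product    : ∀ {A B} → IsProduct (π₁ {A} {B}) (π₂ {A} {B})

  ⟨_,_⟩ : ∀ {X A B} → X ⇒ A → X ⇒ B → X ⇒ A ×₀ B
  ⟨ f , g ⟩ = proj₁ (product f g)

  _×₁_ : ∀ {A B A' B'} → A ⇒ A' → B ⇒ B' → A ×₀ B ⇒ A' ×₀ B'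
  f ×₁ g = ⟨ f ∘ π₁ , g ∘ π₂ ⟩

  ! : ∀ {X} → X ⇒ 𝟙
  ! {X} = proj₁ (𝟙-terminal X)

  field
    ℕ₀   : Obj
    zer  : 𝟙 ⇒ ℕ₀
    suc₀ : ℕ₀ ⇒ ℕ₀
    nno-stable : ∀ {A X} (f : A ⇒ X) (g : X ⇒ X) →
                 ∃!≈ (λ (h : A ×₀ ℕ₀ ⇒ X) →
                        (h ∘ ⟨ id , zer ∘ ! ⟩ ≈ f) × (h ∘ (id ×₁ suc₀) ≈ g ∘ h))

    _^ℕ   : Obj → Obj
    eval  : ∀ {X} → (X ^ℕ) ×₀ ℕ₀ ⇒ X
    curry : ∀ {X Y} (f : Y ×₀ ℕ₀ ⇒ X) →
            ∃!≈ (λ (g : Y ⇒ X ^ℕ) → eval ∘ (g ×₁ id) ≈ f)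

    D     : Obj → Obj
    out   : ∀ {X} → D X ⇒ X + D X
    out⁻¹ : ∀ {X} → X + D X ⇒ D X
    out∘out⁻¹ : ∀ {X} → out {X} ∘ out⁻¹ ≈ id
    out⁻¹∘out : ∀ {X} → out⁻¹ ∘ out {X} ≈ id
    final : ∀ {X Y} (f : Y ⇒ X + Y) →
            ∃!≈ (λ (u : Y ⇒ D X) → out ∘ u ≈ (id +₁ u) ∘ f)

module Derived {o ℓ e} (S : Setting o ℓ e) where
  open Setting S public
  open Category cat public

  coit : ∀ {X Y} → Y ⇒ X + Y → Y ⇒ D X
  coit f = proj₁ (final f)

  now : ∀ {X} → X ⇒ D X
  now = out⁻¹ ∘ inl

  later : ∀ {X} → D X ⇒ D X
  later = out⁻¹ ∘ inr

  Dmap : ∀ {X Y} → X ⇒ Y → D X ⇒ D Y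
  Dmap f = coit ((f +₁ id) ∘ out)

  -- Kleisli extension f* : D X ⇒ D Y of f : X ⇒ D Y, i.e. the unique
  -- morphism with  out ∘ f* ≈ [ out ∘ f , inr ∘ f* ] ∘ out,
  -- obtained by coiteration on D Y + D X
  _* : ∀ {X Y} → X ⇒ D Y → D X ⇒ D Y
  _* {X} {Y} f = coit {Y} {D Y + D X} g ∘ inr
    where
    g : D Y + D X ⇒ Y + (D Y + D X)
    g = [ (id +₁ inl) ∘ out , [ (id +₁ inl) ∘ out ∘ f , inr ∘ inr ] ∘ out ]

  μ : ∀ {X} → D (D X) ⇒ D X
  μ = id *

  IsSearch : ∀ {A} → D A ⇒ A → Set e
  IsSearch a = (a ∘ now ≈ id) × (a ∘ later ≈ a)

  IsDelayAlgebra : ∀ {A} → D A ⇒ A → Set e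
  IsDelayAlgebra a = (a ∘ now ≈ id) × (a ∘ μ ≈ a ∘ Dmap a)

  IsDAlgMorphism : ∀ {A B} → D A ⇒ A → D B ⇒ B → A ⇒ B → Set e
  IsDAlgMorphism a b h = h ∘ a ≈ b ∘ Dmap h

  IterOp : Obj → Set (o ⊔ ℓ)
  IterOp A = ∀ {X} → X ⇒ A + X → X ⇒ A

  record IsUniformIteration (A : Obj) (_† : IterOp A) : Set (o ⊔ ℓ ⊔ e) where
    field
      fixpoint   : ∀ {X} (f : X ⇒ A + X) → f † ≈ [ id , f † ] ∘ f
      uniformity : ∀ {X Y} (f : X ⇒ A + X) (g : Y ⇒ A + Y) (h : X ⇒ Y) →
                   (id +₁ h) ∘ f ≈ g ∘ h → f † ≈ (g †) ∘ h

  record IsElgot (A : Obj) (_† : IterOp A) : Set (o ⊔ ℓ ⊔ e) where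
    field
      isUniformIteration : IsUniformIteration A _†
      compositionality   : ∀ {X Y} (h : Y ⇒ X + Y) (f : X ⇒ A + X) →
        (((f †) +₁ id) ∘ h) † ≈ (([ (id +₁ inl) ∘ f , inr ∘ inr ] ∘ [ inl , h ]) †) ∘ inr

  IsIterMorphism : ∀ {A B} → IterOp A → IterOp B → A ⇒ B → Set (o ⊔ ℓ ⊔ e)
  IsIterMorphism {A} {B} †A †B h = ∀ {X} (f : X ⇒ A + X) → h ∘ †A f ≈ †B ((h +₁ id) ∘ f)

  toDAlg : ∀ {A} → IterOp A → D A ⇒ A
  toDAlg † = † out

  fromDAlg : ∀ {A} → D A ⇒ A → IterOp A
  fromDAlg a f = a ∘ coit f

-- Everything follows from the finality of D and two facts: a D-algebra a is a
-- search-algebra exactly when a ∘ out⁻¹ ≈ [ id , a ], i.e. when a runs an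
-- element of DA until it reaches "now", and, by uniformity along the
-- coalgebra morphism coit f from (X , f) to (DA , out), every uniform
-- iteration operator is determined by its value on out:  f † ≈ out † ∘ coit f.
-- For (2), the multiplication μ of the delay monad is itself a coiteration of
-- the coalgebra occurring in the compositionality law, so compositionality of
-- a ∘ coit (-) and the multiplication law a ∘ μ ≈ a ∘ Dmap a say the same.
module Submission where

open import Defs
open import Level using (Level)
open import Data.Product using (_×_; _,_; proj₁; proj₂)
open import Function.Bundles using (_⇔_; mk⇔)
open import Function.Construct.Composition using (_⇔-∘_)
open import Function.Construct.Symmetry using (⇔-sym)
open import Relation.Binary using (IsEquivalence; Setoid)
import Relation.Binary.Reasoning.Setoid as SetoidReasoning

module Properties {o ℓ e : Level} (S : Setting o ℓ e) where
  open Derived S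

  hom-setoid : Obj → Obj → Setoid ℓ e
  hom-setoid A B = record { Carrier = A ⇒ B ; _≈_ = _≈_ ; isEquivalence = equiv }

  open module HomReasoning {A B : Obj} = SetoidReasoning (hom-setoid A B)
  open module HomEquivalence {A B : Obj} = IsEquivalence (equiv {A} {B})
    using (refl; sym; trans)

  infixr 4 refl⟩∘⟨_
  infixl 5 _⟩∘⟨refl

  refl⟩∘⟨_ : ∀ {A B C} {f : B ⇒ C} {g i : A ⇒ B} → g ≈ i → f ∘ g ≈ f ∘ i
  refl⟩∘⟨ p = ∘-resp-≈ refl p

  _⟩∘⟨refl : ∀ {A B C} {f h : B ⇒ C} {g : A ⇒ B} → f ≈ h → f ∘ g ≈ h ∘ g
  p ⟩∘⟨refl = ∘-resp-≈ p refl

  sym-assoc : ∀ {A B C D} {f : A ⇒ B} {g : B ⇒ C} {h : C ⇒ D} → h ∘ (g ∘ f) ≈ (h ∘ g) ∘ f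
  sym-assoc = sym assoc

  module _ {A B X : Obj} {f : A ⇒ X} {g : B ⇒ X} where

    inject₁ : [ f , g ] ∘ inl ≈ f
    inject₁ = proj₁ (proj₁ (proj₂ (coproduct f g)))

    inject₂ : [ f , g ] ∘ inr ≈ g
    inject₂ = proj₂ (proj₁ (proj₂ (coproduct f g)))

    []-unique : ∀ {u : A + B ⇒ X} → u ∘ inl ≈ f → u ∘ inr ≈ g → u ≈ [ f , g ]
    []-unique {u} p q = proj₂ (proj₂ (coproduct f g)) u (p , q)

  []-cong₂ : ∀ {A B X} {f f′ : A ⇒ X} {g g′ : B ⇒ X} →
             f ≈ f′ → g ≈ g′ → [ f , g ] ≈ [ f′ , g′ ]
  []-cong₂ p q = []-unique (trans inject₁ p) (trans inject₂ q)

  ∘-distribˡ-[] : ∀ {A B X Y} {f : A ⇒ X} {g : B ⇒ X} {h : X ⇒ Y} →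
                  h ∘ [ f , g ] ≈ [ h ∘ f , h ∘ g ]
  ∘-distribˡ-[] = []-unique (trans assoc (refl⟩∘⟨ inject₁)) (trans assoc (refl⟩∘⟨ inject₂))

  []∘+₁ : ∀ {A B A′ B′ X} {f : A′ ⇒ X} {g : B′ ⇒ X} {h : A ⇒ A′} {k : B ⇒ B′} →
          [ f , g ] ∘ (h +₁ k) ≈ [ f ∘ h , g ∘ k ]
  []∘+₁ = trans ∘-distribˡ-[]
                ([]-cong₂ (trans sym-assoc (inject₁ ⟩∘⟨refl)) (trans sym-assoc (inject₂ ⟩∘⟨refl)))

  +₁∘+₁ : ∀ {A B A′ B′ A″ B″} {f : A′ ⇒ A″} {g : B′ ⇒ B″} {h : A ⇒ A′} {k : B ⇒ B′} →
          (f +₁ g) ∘ (h +₁ k) ≈ (f ∘ h) +₁ (g ∘ k)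
  +₁∘+₁ = trans []∘+₁ ([]-cong₂ assoc assoc)

  +₁-cong₂ : ∀ {A B A′ B′} {f f′ : A ⇒ A′} {g g′ : B ⇒ B′} →
             f ≈ f′ → g ≈ g′ → f +₁ g ≈ f′ +₁ g′
  +₁-cong₂ p q = []-cong₂ (refl⟩∘⟨ p) (refl⟩∘⟨ q)

  +₁-identity : ∀ {A B} → id {A} +₁ id {B} ≈ id
  +₁-identity = sym ([]-unique (trans identityˡ (sym identityʳ)) (trans identityˡ (sym identityʳ)))

  +₁-commute : ∀ {A B A′ B′} {f : A ⇒ A′} {g : B ⇒ B′} →
               (id +₁ g) ∘ (f +₁ id) ≈ (f +₁ id) ∘ (id +₁ g)
  +₁-commute {f = f} {g} = begin
    (id +₁ g) ∘ (f +₁ id)   ≈⟨ +₁∘+₁ ⟩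
    (id ∘ f) +₁ (g ∘ id)    ≈⟨ +₁-cong₂ (trans identityˡ (sym identityʳ)) (trans identityʳ (sym identityˡ)) ⟩
    (f ∘ id) +₁ (id ∘ g)    ≈⟨ +₁∘+₁ ⟨
    (f +₁ id) ∘ (id +₁ g)   ∎

  out-transpose : ∀ {A X} {x : D A ⇒ X} {y : A + D A ⇒ X} → x ≈ y ∘ out → x ∘ out⁻¹ ≈ y
  out-transpose {x = x} {y} p = begin
    x ∘ out⁻¹           ≈⟨ p ⟩∘⟨refl ⟩
    (y ∘ out) ∘ out⁻¹   ≈⟨ assoc ⟩
    y ∘ (out ∘ out⁻¹)   ≈⟨ refl⟩∘⟨ out∘out⁻¹ ⟩
    y ∘ id              ≈⟨ identityʳ ⟩
    y                   ∎

  out⁻¹-transpose : ∀ {A X} {x : D A ⇒ X} {y : A + D A ⇒ X} → x ∘ out⁻¹ ≈ y → x ≈ y ∘ out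
  out⁻¹-transpose {x = x} {y} p = begin
    x                   ≈⟨ identityʳ ⟨
    x ∘ id              ≈⟨ refl⟩∘⟨ out⁻¹∘out ⟨
    x ∘ (out⁻¹ ∘ out)   ≈⟨ sym-assoc ⟩
    (x ∘ out⁻¹) ∘ out   ≈⟨ p ⟩∘⟨refl ⟩
    y ∘ out             ∎

  coit-commute : ∀ {X Y} {f : Y ⇒ X + Y} → out ∘ coit f ≈ (id +₁ coit f) ∘ f
  coit-commute {f = f} = proj₁ (proj₂ (final f))

  coit-unique : ∀ {X Y} {f : Y ⇒ X + Y} {u : Y ⇒ D X} →
                out ∘ u ≈ (id +₁ u) ∘ f → u ≈ coit f
  coit-unique {f = f} {u} p = proj₂ (proj₂ (final f)) u p

  coit-fusion : ∀ {X Y Z} {f : Y ⇒ X + Y} {g : Z ⇒ X + Z} {h : Y ⇒ Z} →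
                (id +₁ h) ∘ f ≈ g ∘ h → coit f ≈ coit g ∘ h
  coit-fusion {f = f} {g} {h} p = sym (coit-unique (begin
    out ∘ (coit g ∘ h)                ≈⟨ sym-assoc ⟩
    (out ∘ coit g) ∘ h                ≈⟨ coit-commute ⟩∘⟨refl ⟩
    ((id +₁ coit g) ∘ g) ∘ h          ≈⟨ assoc ⟩
    (id +₁ coit g) ∘ (g ∘ h)          ≈⟨ refl⟩∘⟨ p ⟨
    (id +₁ coit g) ∘ ((id +₁ h) ∘ f)  ≈⟨ sym-assoc ⟩
    ((id +₁ coit g) ∘ (id +₁ h)) ∘ f  ≈⟨ trans +₁∘+₁ (+₁-cong₂ identityˡ refl) ⟩∘⟨refl ⟩
    (id +₁ (coit g ∘ h)) ∘ f          ∎))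

  coit-cong : ∀ {X Y} {f g : Y ⇒ X + Y} → f ≈ g → coit f ≈ coit g
  coit-cong p = coit-unique (trans coit-commute (refl⟩∘⟨ p))

  coit-out : ∀ {X} → coit (out {X}) ≈ id
  coit-out = sym (coit-unique (trans identityʳ (sym (trans (+₁-identity ⟩∘⟨refl) identityˡ))))

  Dmap∘coit : ∀ {X Y Z} {h : X ⇒ Z} {f : Y ⇒ X + Y} → Dmap h ∘ coit f ≈ coit ((h +₁ id) ∘ f)
  Dmap∘coit {h = h} {f} = sym (coit-fusion (begin
    (id +₁ coit f) ∘ ((h +₁ id) ∘ f)  ≈⟨ sym-assoc ⟩
    ((id +₁ coit f) ∘ (h +₁ id)) ∘ f  ≈⟨ +₁-commute ⟩∘⟨refl ⟩
    ((h +₁ id) ∘ (id +₁ coit f)) ∘ f  ≈⟨ assoc ⟩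
    (h +₁ id) ∘ ((id +₁ coit f) ∘ f)  ≈⟨ refl⟩∘⟨ coit-commute ⟨
    (h +₁ id) ∘ (out ∘ coit f)        ≈⟨ sym-assoc ⟩
    ((h +₁ id) ∘ out) ∘ coit f        ∎))

  module _ {X Y : Obj} (f : X ⇒ D Y) where

    private
      extend : D Y + D X ⇒ Y + (D Y + D X)
      extend = [ (id +₁ inl) ∘ out , [ (id +₁ inl) ∘ out ∘ f , inr ∘ inr ] ∘ out ]

      coit-extend∘inl : coit extend ∘ inl ≈ id
      coit-extend∘inl = trans (sym (coit-fusion (sym inject₁))) coit-out

    out∘* : out ∘ (f *) ≈ [ out ∘ f , inr ∘ (f *) ] ∘ out
    out∘* = begin
      out ∘ (coit extend ∘ inr)                                 ≈⟨ sym-assoc ⟩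
      (out ∘ coit extend) ∘ inr                                 ≈⟨ coit-commute ⟩∘⟨refl ⟩
      ((id +₁ coit extend) ∘ extend) ∘ inr                      ≈⟨ assoc ⟩
      (id +₁ coit extend) ∘ (extend ∘ inr)                      ≈⟨ refl⟩∘⟨ inject₂ ⟩
      (id +₁ coit extend) ∘ ([ (id +₁ inl) ∘ out ∘ f , inr ∘ inr ] ∘ out)
                                                                ≈⟨ sym-assoc ⟩
      ((id +₁ coit extend) ∘ [ (id +₁ inl) ∘ out ∘ f , inr ∘ inr ]) ∘ out
                                                                ≈⟨ trans ∘-distribˡ-[] ([]-cong₂ now-step later-step) ⟩∘⟨refl ⟩
      [ out ∘ f , inr ∘ (coit extend ∘ inr) ] ∘ out             ∎
      where
      now-step : (id +₁ coit extend) ∘ ((id +₁ inl) ∘ out ∘ f) ≈ out ∘ f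
      now-step = begin
        (id +₁ coit extend) ∘ ((id +₁ inl) ∘ out ∘ f)  ≈⟨ sym-assoc ⟩
        ((id +₁ coit extend) ∘ (id +₁ inl)) ∘ out ∘ f  ≈⟨ +₁∘+₁ ⟩∘⟨refl ⟩
        ((id ∘ id) +₁ (coit extend ∘ inl)) ∘ out ∘ f   ≈⟨ trans (+₁-cong₂ identityˡ coit-extend∘inl) +₁-identity ⟩∘⟨refl ⟩
        id ∘ out ∘ f                                   ≈⟨ identityˡ ⟩
        out ∘ f                                        ∎
      later-step : (id +₁ coit extend) ∘ (inr ∘ inr) ≈ inr ∘ (coit extend ∘ inr)
      later-step = trans sym-assoc (trans (inject₂ ⟩∘⟨refl) assoc)

  out∘μ : ∀ {X} → out ∘ μ {X} ≈ [ out , inr ∘ μ ] ∘ out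
  out∘μ = trans (out∘* id) ([]-cong₂ identityʳ refl ⟩∘⟨refl)

  -- The coalgebra on X + Y in the compositionality law: run h, and once it
  -- exits into X continue with f.
  flatten : ∀ {A X Y} → Y ⇒ X + Y → X ⇒ A + X → X + Y ⇒ A + (X + Y)
  flatten h f = [ (id +₁ inl) ∘ f , inr ∘ inr ] ∘ [ inl , h ]

  -- [ coit f , μ ∘ w ] is a coalgebra morphism out of flatten h f, hence
  -- equals coit (flatten h f) by finality.
  μ∘coit-flatten : ∀ {A X Y} (h : Y ⇒ X + Y) (f : X ⇒ A + X) →
                   μ ∘ coit ((coit f +₁ id) ∘ h) ≈ coit (flatten h f) ∘ inr
  μ∘coit-flatten {A} {X} {Y} h f = begin
    μ ∘ w                      ≈⟨ inject₂ ⟨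
    u ∘ inr                    ≈⟨ coit-unique u-coalgebra ⟩∘⟨refl ⟩
    coit (flatten h f) ∘ inr   ∎
    where
    w : Y ⇒ D (D A)
    w = coit ((coit f +₁ id) ∘ h)
    u : X + Y ⇒ D A
    u = [ coit f , μ ∘ w ]
    run-f : X ⇒ A + D A
    run-f = (id +₁ coit f) ∘ f
    run-h : X + Y ⇒ A + D A
    run-h = [ run-f , inr ∘ (μ ∘ w) ]

    out∘μ∘w : out ∘ (μ ∘ w) ≈ run-h ∘ h
    out∘μ∘w = begin
      out ∘ (μ ∘ w)                                        ≈⟨ sym-assoc ⟩
      (out ∘ μ) ∘ w                                        ≈⟨ out∘μ ⟩∘⟨refl ⟩
      ([ out , inr ∘ μ ] ∘ out) ∘ w                        ≈⟨ assoc ⟩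
      [ out , inr ∘ μ ] ∘ (out ∘ w)                        ≈⟨ refl⟩∘⟨ coit-commute ⟩
      [ out , inr ∘ μ ] ∘ ((id +₁ w) ∘ ((coit f +₁ id) ∘ h))  ≈⟨ refl⟩∘⟨ sym-assoc ⟩
      [ out , inr ∘ μ ] ∘ (((id +₁ w) ∘ (coit f +₁ id)) ∘ h)  ≈⟨ refl⟩∘⟨ trans +₁∘+₁ (+₁-cong₂ identityˡ identityʳ) ⟩∘⟨refl ⟩
      [ out , inr ∘ μ ] ∘ ((coit f +₁ w) ∘ h)              ≈⟨ sym-assoc ⟩
      ([ out , inr ∘ μ ] ∘ (coit f +₁ w)) ∘ h              ≈⟨ trans []∘+₁ ([]-cong₂ coit-commute assoc) ⟩∘⟨refl ⟩
      run-h ∘ h                                            ∎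

    u-coalgebra : out ∘ u ≈ (id +₁ u) ∘ flatten h f
    u-coalgebra = begin
      out ∘ u                                                ≈⟨ ∘-distribˡ-[] ⟩
      [ out ∘ coit f , out ∘ (μ ∘ w) ]                       ≈⟨ []-cong₂ coit-commute out∘μ∘w ⟩
      [ run-f , run-h ∘ h ]                                  ≈⟨ trans ∘-distribˡ-[] ([]-cong₂ inject₁ refl) ⟨
      run-h ∘ [ inl , h ]                                    ≈⟨ trans ∘-distribˡ-[] ([]-cong₂ exit-step loop-step) ⟩∘⟨refl ⟨
      ((id +₁ u) ∘ [ (id +₁ inl) ∘ f , inr ∘ inr ]) ∘ [ inl , h ]  ≈⟨ assoc ⟩
      (id +₁ u) ∘ flatten h f                                ∎
      where
      exit-step : (id +₁ u) ∘ ((id +₁ inl) ∘ f) ≈ run-f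
      exit-step = trans sym-assoc (trans +₁∘+₁ (+₁-cong₂ identityˡ inject₁) ⟩∘⟨refl)
      loop-step : (id +₁ u) ∘ (inr ∘ inr) ≈ inr ∘ (μ ∘ w)
      loop-step = trans sym-assoc (trans (inject₂ ⟩∘⟨refl) (trans assoc (refl⟩∘⟨ inject₂)))

  μ≈coit-flatten : ∀ {A} → μ {A} ≈ coit (flatten out out) ∘ inr
  μ≈coit-flatten = begin
    μ                                   ≈⟨ identityʳ ⟨
    μ ∘ id                              ≈⟨ refl⟩∘⟨ trans (coit-cong id+₁coit-out∘out) coit-out ⟨
    μ ∘ coit ((coit out +₁ id) ∘ out)   ≈⟨ μ∘coit-flatten out out ⟩
    coit (flatten out out) ∘ inr        ∎
    where
    id+₁coit-out∘out : (coit out +₁ id) ∘ out ≈ out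
    id+₁coit-out∘out = trans (trans (+₁-cong₂ coit-out refl) +₁-identity ⟩∘⟨refl) identityˡ

  module _ {A : Obj} {a : D A ⇒ A} where

    IsSearch-intro : a ∘ out⁻¹ ≈ [ id , a ] → IsSearch a
    IsSearch-intro p = trans sym-assoc (trans (p ⟩∘⟨refl) inject₁)
                     , trans sym-assoc (trans (p ⟩∘⟨refl) inject₂)

    IsSearch-out⁻¹ : IsSearch a → a ∘ out⁻¹ ≈ [ id , a ]
    IsSearch-out⁻¹ (a∘now , a∘later) = []-unique (trans assoc a∘now) (trans assoc a∘later)

    toDAlg∘fromDAlg : toDAlg (fromDAlg a) ≈ a
    toDAlg∘fromDAlg = trans (refl⟩∘⟨ coit-out) identityʳ

    fromDAlg-isUniformIteration : IsSearch a → IsUniformIteration A (fromDAlg a)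
    fromDAlg-isUniformIteration s = record
      { fixpoint   = λ f → begin
          a ∘ coit f                      ≈⟨ out⁻¹-transpose (IsSearch-out⁻¹ s) ⟩∘⟨refl ⟩
          ([ id , a ] ∘ out) ∘ coit f     ≈⟨ assoc ⟩
          [ id , a ] ∘ (out ∘ coit f)     ≈⟨ refl⟩∘⟨ coit-commute ⟩
          [ id , a ] ∘ ((id +₁ coit f) ∘ f)  ≈⟨ sym-assoc ⟩
          ([ id , a ] ∘ (id +₁ coit f)) ∘ f  ≈⟨ trans []∘+₁ ([]-cong₂ identityˡ refl) ⟩∘⟨refl ⟩
          [ id , a ∘ coit f ] ∘ f         ∎
      ; uniformity = λ f g h p → trans (refl⟩∘⟨ coit-fusion p) sym-assoc
      }

  module _ {A : Obj} {_† : IterOp A} (u : IsUniformIteration A _†) where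
    open IsUniformIteration u

    toDAlg-isSearch : IsSearch (toDAlg _†)
    toDAlg-isSearch = IsSearch-intro (out-transpose (fixpoint out))

    toDAlg∘coit : ∀ {X} (f : X ⇒ A + X) → toDAlg _† ∘ coit f ≈ f †
    toDAlg∘coit f = sym (uniformity f out (coit f) (sym coit-commute))

  module _ {A B : Obj} (a : D A ⇒ A) (b : D B ⇒ B) (h : A ⇒ B) where

    IsDAlgMorphism⇔IsIterMorphism : IsDAlgMorphism a b h ⇔ IsIterMorphism (fromDAlg a) (fromDAlg b) h
    IsDAlgMorphism⇔IsIterMorphism = mk⇔ to from
      where
      to : IsDAlgMorphism a b h → IsIterMorphism (fromDAlg a) (fromDAlg b) h
      to m f = begin
        h ∘ (a ∘ coit f)          ≈⟨ sym-assoc ⟩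
        (h ∘ a) ∘ coit f          ≈⟨ m ⟩∘⟨refl ⟩
        (b ∘ Dmap h) ∘ coit f     ≈⟨ assoc ⟩
        b ∘ (Dmap h ∘ coit f)     ≈⟨ refl⟩∘⟨ Dmap∘coit ⟩
        b ∘ coit ((h +₁ id) ∘ f)  ∎
      from : IsIterMorphism (fromDAlg a) (fromDAlg b) h → IsDAlgMorphism a b h
      from m = trans (refl⟩∘⟨ sym toDAlg∘fromDAlg) (m out)

  IsIterMorphism-cong : ∀ {A B} {†A †A′ : IterOp A} {†B †B′ : IterOp B} {h : A ⇒ B} →
                        (∀ {X} (f : X ⇒ A + X) → †A f ≈ †A′ f) →
                        (∀ {X} (f : X ⇒ B + X) → †B f ≈ †B′ f) →
                        IsIterMorphism †A †B h ⇔ IsIterMorphism †A′ †B′ h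
  IsIterMorphism-cong {h = h} eqA eqB = mk⇔
    (λ m {_} f → trans (refl⟩∘⟨ sym (eqA f)) (trans (m f) (eqB ((h +₁ id) ∘ f))))
    (λ m {_} f → trans (refl⟩∘⟨ eqA f) (trans (m f) (sym (eqB ((h +₁ id) ∘ f)))))

  IsIterMorphism⇔IsDAlgMorphism : ∀ {A B} {†A : IterOp A} {†B : IterOp B} →
    IsUniformIteration A †A → IsUniformIteration B †B → (h : A ⇒ B) →
    IsIterMorphism †A †B h ⇔ IsDAlgMorphism (toDAlg †A) (toDAlg †B) h
  IsIterMorphism⇔IsDAlgMorphism uA uB h =
    ⇔-sym (IsDAlgMorphism⇔IsIterMorphism _ _ h)
      ⇔-∘ IsIterMorphism-cong (λ f → sym (toDAlg∘coit uA f)) (λ f → sym (toDAlg∘coit uB f))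

  IsElgot⇒IsSearch×IsDelayAlgebra : ∀ {A} {_† : IterOp A} → IsElgot A _† →
                                    IsSearch (toDAlg _†) × IsDelayAlgebra (toDAlg _†)
  IsElgot⇒IsSearch×IsDelayAlgebra {A} {_†} elgot = search , proj₁ search , (begin
    out † ∘ μ                                ≈⟨ refl⟩∘⟨ μ≈coit-flatten ⟩
    out † ∘ (coit (flatten out out) ∘ inr)   ≈⟨ sym-assoc ⟩
    (out † ∘ coit (flatten out out)) ∘ inr   ≈⟨ toDAlg∘coit isUniformIteration _ ⟩∘⟨refl ⟩
    flatten out out † ∘ inr                  ≈⟨ compositionality out out ⟨
    (((out †) +₁ id) ∘ out) †                ≈⟨ toDAlg∘coit isUniformIteration _ ⟨
    out † ∘ coit (((out †) +₁ id) ∘ out)     ∎)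
    where
    open IsElgot elgot
    search = toDAlg-isSearch isUniformIteration

  IsDelayAlgebra⇒Elgot : ∀ {A} {a : D A ⇒ A} → IsSearch a → IsDelayAlgebra a → IsElgot A (fromDAlg a)
  IsDelayAlgebra⇒Elgot {A} {a} s (_ , a∘μ) = record
    { isUniformIteration = fromDAlg-isUniformIteration s
    ; compositionality   = λ h f → begin
        a ∘ coit (((a ∘ coit f) +₁ id) ∘ h)          ≈⟨ refl⟩∘⟨ coit-cong (split-a h f) ⟩
        a ∘ coit ((a +₁ id) ∘ ((coit f +₁ id) ∘ h))  ≈⟨ refl⟩∘⟨ Dmap∘coit ⟨
        a ∘ (Dmap a ∘ coit ((coit f +₁ id) ∘ h))     ≈⟨ sym-assoc ⟩
        (a ∘ Dmap a) ∘ coit ((coit f +₁ id) ∘ h)     ≈⟨ a∘μ ⟩∘⟨refl ⟨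
        (a ∘ μ) ∘ coit ((coit f +₁ id) ∘ h)          ≈⟨ assoc ⟩
        a ∘ (μ ∘ coit ((coit f +₁ id) ∘ h))          ≈⟨ refl⟩∘⟨ μ∘coit-flatten h f ⟩
        a ∘ (coit (flatten h f) ∘ inr)               ≈⟨ sym-assoc ⟩
        (a ∘ coit (flatten h f)) ∘ inr               ∎
    }
    where
    split-a : ∀ {X Y} (h : Y ⇒ X + Y) (f : X ⇒ A + X) →
              ((a ∘ coit f) +₁ id) ∘ h ≈ (a +₁ id) ∘ ((coit f +₁ id) ∘ h)
    split-a h f = trans (sym (trans +₁∘+₁ (+₁-cong₂ refl identityˡ)) ⟩∘⟨refl) assoc

proposition6p2 : ∀ {o ℓ e : Level} (S : Setting o ℓ e) → let open Derived S in
    ( (∀ {A} (_† : IterOp A) → IsUniformIteration A _† → IsSearch (toDAlg _†))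
    × (∀ {A} (a : D A ⇒ A) → IsSearch a → IsUniformIteration A (fromDAlg a))
    × (∀ {A} (a : D A ⇒ A) → IsSearch a → toDAlg (fromDAlg a) ≈ a)
    × (∀ {A} (_† : IterOp A) → IsUniformIteration A _† →
         ∀ {X} (f : X ⇒ A + X) → fromDAlg (toDAlg _†) f ≈ f †)
    × (∀ {A B} (†A : IterOp A) (†B : IterOp B) →
         IsUniformIteration A †A → IsUniformIteration B †B → (h : A ⇒ B) →
         IsIterMorphism †A †B h ⇔ IsDAlgMorphism (toDAlg †A) (toDAlg †B) h)
    × (∀ {A B} (a : D A ⇒ A) (b : D B ⇒ B) → IsSearch a → IsSearch b → (h : A ⇒ B) →
         IsDAlgMorphism a b h ⇔ IsIterMorphism (fromDAlg a) (fromDAlg b) h) )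
    × ( (∀ {A} (_† : IterOp A) → IsElgot A _† →
           IsSearch (toDAlg _†) × IsDelayAlgebra (toDAlg _†))
      × (∀ {A} (a : D A ⇒ A) → IsSearch a → IsDelayAlgebra a → IsElgot A (fromDAlg a)) )
proposition6p2 S =
  ( (λ _ → toDAlg-isSearch)
  , (λ _ → fromDAlg-isUniformIteration)
  , (λ _ _ → toDAlg∘fromDAlg)
  , (λ _ → toDAlg∘coit)
  , (λ _ _ → IsIterMorphism⇔IsDAlgMorphism)
  , (λ a b _ _ → IsDAlgMorphism⇔IsIterMorphism a b) )
  , ( (λ _ → IsElgot⇒IsSearch×IsDelayAlgebra)
    , (λ _ → IsDelayAlgebra⇒Elgot) )
  where open Properties S
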